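{- Let $n,k\ge1$ and $\sigma=\sigma_1\cdots\sigma_n\in\mathfrak{S}_n$. The map sending $T\in\mathrm{SYT}(k^n)$ to the word $\pi=\sigma_{\operatorname{row}(1)}\sigma_{\operatorname{row}(2)}\cdots\sigma_{\operatorname{row}(kn)}$ is a bijection from $\mathrm{SYT}(k^n)$ to $\mathcal{C}^{k,\sigma}_n$. Moreover, for every $T$, $\operatorname{Des}_\sigma(T)=\operatorname{Des}(\pi)$ and $\operatorname{Plat}(T)=\operatorname{Plat}(\pi)$; consequently $$\sum_{T\in\mathrm{SYT}(k^n)}t^{\operatorname{des}_\sigma(T)}u^{\operatorname{plat}(T)}=C^{k,\sigma}_n(t,u).$$
   Context: $\mathfrak{S}_n$ is the set of permutations of $[n]$. For a word $\pi=\pi_1\cdots\pi_m$, $\operatorname{Des}(\pi)=\{i\in[m-1]:\pi_i>\pi_{i+1}\}$, $\operatorname{Plat}(\pi)=\{i\in[m-1]:\pi_i=\pi_{i+1}\}$, $\operatorname{des}(\pi)=|\operatorname{Des}(\pi)|$, $\operatorname{plat}(\pi)=|\operatorname{Plat}(\pi)|$. A canon permutation is a permutation $\pi$ of the multiset $\{1^k,\dots,n^k\}$ such that for each $j\in[k]$ the subsequence formed by the $j$th copy from the left of each number in $[n]$ is the same permutation $\sigma\in\mathfrak{S}_n$ for all $j$; $\mathcal{C}^{k,\sigma}_n$ denotes the set of canon permutations with this common subsequence equal to $\sigma$, and $C^{k,\sigma}_n(t,u)=\sum_{\pi\in\mathcal{C}^{k,\sigma}_n}t^{\operatorname{des}(\pi)}u^{\operatorname{plat}(\pi)}$.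 $\mathrm{SYT}(k^n)$ is the set of standard Young tableaux of rectangular shape with $n$ rows and $k$ columns, filled with $1,\dots,kn$. For $T\in\mathrm{SYT}(k^n)$, $\operatorname{row}(i)$ is the index (from $1$ at the top to $n$ at the bottom) of the row containing $i$. Define $\operatorname{Des}_\sigma(T)=\{i\in[kn-1]:\sigma_{\operatorname{row}(i)}>\sigma_{\operatorname{row}(i+1)}\}$, $\operatorname{des}_\sigma(T)=|\operatorname{Des}_\sigma(T)|$, $\operatorname{Plat}(T)=\{i\in[kn-1]:\operatorname{row}(i)=\operatorname{row}(i+1)\}$, $\operatorname{plat}(T)=|\operatorname{Plat}(T)|$. -}

module Defs where

open import Data.Nat using (ℕ; zero; suc; _+_; _*_; _^_)
import Data.Nat as ℕ
open import Data.Nat.Properties using (*-zeroʳ)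
open import Data.Bool using (Bool; true; false; if_then_else_)
open import Data.Fin using (Fin; zero; suc; toℕ; _<_)
open import Data.Fin.Properties using (_<?_; any?; all?) renaming (_≟_ to _≟ᶠ_)
open import Data.Fin.Permutation using (Permutation′; _⟨$⟩ʳ_)
open import Data.Fin.Subset using (Subset; Side; inside; outside; ∣_∣)
open import Data.List using (List; []; _∷_; concatMap; allFin; filter)
open import Data.Nat.ListAction using (sum)
import Data.List as List
open import Data.List.Properties using () renaming (≡-dec to ≡-decᴸ)
open import Data.Vec using (Vec; []; _∷_; lookup; tabulate; toList)
import Data.Vec as Vec
open import Data.Product using (Σ; ∃; _×_; _,_; proj₁)
open import Relation.Nullary using (Dec; yes; no; does)
open import Relation.Nullary.Decidable using (_×-dec_; _→-dec_)
open import Relation.Binary.PropositionalEquality using (_≡_; refl)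
open import Function using (case_of_)

-- Conventions: [n] is represented by Fin n (value v : Fin n stands for
-- v+1), positions 1..m of a word by Fin m (position p stands for p+1),
-- rows 1..n of a tableau by Fin n (row 0 = top row), columns by Fin k.

-- The last position is never included, so this is a subset of [m-1].

toSide : Bool → Side
toSide true  = inside
toSide false = outside

adjSet : ∀ {A : Set} {m} → (A → A → Bool) → Vec A m → Subset m
adjSet R []            = []
adjSet R (x ∷ [])      = outside ∷ []
adjSet R (x ∷ y ∷ ws)  = toSide (R x y) ∷ adjSet R (y ∷ ws)

Des : ∀ {n m} → Vec (Fin n) m → Subset m
Des = adjSet (λ x y → does (y <? x))

Plat : ∀ {n m} → Vec (Fin n) m → Subset m
Plat = adjSet (λ x y → does (x ≟ᶠ y))

des : ∀ {n m} → Vec (Fin n) m → ℕ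
des w = ∣ Des w ∣

plat : ∀ {n m} → Vec (Fin n) m → ℕ
plat w = ∣ Plat w ∣

occ : ∀ {n} → Fin n → List (Fin n) → ℕ
occ x []       = 0
occ x (y ∷ ys) = (if does (x ≟ᶠ y) then 1 else 0) + occ x ys

-- jthCopies j seen xs : subsequence of xs consisting of those letters
-- that are the (j+1)-st copy from the left of their value, where
-- `seen` is the (reversed) prefix already read.
jthCopies : ∀ {n} → ℕ → List (Fin n) → List (Fin n) → List (Fin n)
jthCopies j seen []       = []
jthCopies j seen (x ∷ xs) =
  if does (occ x seen ℕ.≟ j)
  then x ∷ jthCopies j (x ∷ seen) xs
  else jthCopies j (x ∷ seen) xs

permWord : ∀ {n} → Permutation′ n → List (Fin n)
permWord {n} σ = List.map (σ ⟨$⟩ʳ_) (allFin n)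

IsCanon : ∀ {n} (k : ℕ) → Permutation′ n → Vec (Fin n) (k * n) → Set
IsCanon {n} k σ π =
  ((v : Fin n) → occ v (toList π) ≡ k) ×
  ((j : Fin k) → jthCopies (toℕ j) [] (toList π) ≡ permWord σ)

isCanon? : ∀ {n} k σ (π : Vec (Fin n) (k * n)) → Dec (IsCanon k σ π)
isCanon? k σ π =
  all? (λ v → occ v (toList π) ℕ.≟ k) ×-dec
  all? (λ j → ≡-decᴸ _≟ᶠ_ (jthCopies (toℕ j) [] (toList π)) (permWord σ))

-- Tableaux of rectangular shape k^n (n rows, k columns), filled with
-- values in Fin (k * n) (value v stands for v+1).

Tableau : ℕ → ℕ → Set
Tableau k n = Vec (Vec (Fin (k * n)) k) n

entry : ∀ {k n} → Tableau k n → Fin n → Fin k → Fin (k * n)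
entry T r c = lookup (lookup T r) c

occT : ∀ {k n} → Tableau k n → Fin (k * n) → ℕ
occT T v = sum (Vec.toList (Vec.map (λ row → occ v (toList row)) T))

IsSYT : ∀ {k n} → Tableau k n → Set
IsSYT {k} {n} T =
  ((v : Fin (k * n)) → occT T v ≡ 1) ×
  ((r : Fin n) (c c′ : Fin k) → c < c′ → entry T r c < entry T r c′) ×
  ((r r′ : Fin n) (c : Fin k) → r < r′ → entry T r c < entry T r′ c)

isSYT? : ∀ {k n} (T : Tableau k n) → Dec (IsSYT T)
isSYT? T =
  all? (λ v → occT T v ℕ.≟ 1) ×-dec
  all? (λ r → all? λ c → all? λ c′ → (c <? c′) →-dec (entry T r c <? entry T r c′)) ×-dec
  all? (λ r → all? λ r′ → all? λ c → (r <? r′) →-dec (entry T r c <? entry T r′ c))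

finRow : ∀ {k n} → Fin (k * n) → Fin n
finRow {k} {zero}  i with k * 0 | *-zeroʳ k
... | .0 | refl = case i of λ ()
finRow {k} {suc n} i = zero

-- row(i): the row of T containing the entry i.  (For a tableau in which
-- i does not occur -- never the case for an SYT -- a default row is used.)
rowOf : ∀ {k n} → Tableau k n → Fin (k * n) → Fin n
rowOf {k} {n} T i with any? (λ r → any? (λ c → entry T r c ≟ᶠ i))
... | yes (r , _) = r
... | no _        = finRow {k} {n} i

rowWord : ∀ {k n} → Tableau k n → Vec (Fin n) (k * n)
rowWord T = tabulate (rowOf T)

Desσ : ∀ {k n} → Permutation′ n → Tableau k n → Subset (k * n)
Desσ σ T = adjSet (λ a b → does ((σ ⟨$⟩ʳ b) <? (σ ⟨$⟩ʳ a))) (rowWord T)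

PlatT : ∀ {k n} → Tableau k n → Subset (k * n)
PlatT T = adjSet (λ a b → does (a ≟ᶠ b)) (rowWord T)

desσ : ∀ {k n} → Permutation′ n → Tableau k n → ℕ
desσ σ T = ∣ Desσ σ T ∣

platT : ∀ {k n} → Tableau k n → ℕ
platT T = ∣ PlatT T ∣

canonWord : ∀ {k n} → Permutation′ n → Tableau k n → Vec (Fin n) (k * n)
canonWord σ T = tabulate (λ i → σ ⟨$⟩ʳ rowOf T i)

allVecs : ∀ {A : Set} → List A → (m : ℕ) → List (Vec A m)
allVecs xs zero    = [] ∷ []
allVecs xs (suc m) = concatMap (λ x → List.map (x ∷_) (allVecs xs m)) xs

allCanon : ∀ {n} (k : ℕ) → Permutation′ n → List (Vec (Fin n) (k * n))
allCanon {n} k σ = filter (isCanon? k σ) (allVecs (allFin n) (k * n))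

allSYT : (k n : ℕ) → List (Tableau k n)
allSYT k n = filter isSYT? (allVecs (allVecs (allFin (k * n)) k) n)

C : ∀ {n} (k : ℕ) → Permutation′ n → ℕ → ℕ → ℕ
C k σ t u = sum (List.map (λ π → t ^ des π * u ^ plat π) (allCanon k σ))

SYTgf : (k n : ℕ) → Permutation′ n → ℕ → ℕ → ℕ
SYTgf k n σ t u = sum (List.map (λ T → t ^ desσ σ T * u ^ platT T) (allSYT k n))

module Submission where

-- Row r
-- contributes exactly the positions of the copies of σ_r, and since rows increase the
-- entry in column c of row r is the (c+1)-st copy of σ_r.  Hence the (c+1)-st copies
-- are the entries of column c, which increase down the column, so they spell σ_1 ⋯ σ_n:
-- the word is canon.  Conversely, in a canon permutation the cell (r, c) is forced to hold
-- the position of the (c+1)-st copy of σ_r; this is a standard tableau because copies of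
-- one letter come in order (rows) and the (c+1)-st copies come in the order σ_1 ⋯ σ_n
-- (columns).  Descents and plateaux are preserved since σ is injective, and the
-- generating functions agree because the map is a bijection between the enumerations.

open import Defs
open import Data.Bool using (Bool; true; false; if_then_else_)
open import Data.Empty using (⊥; ⊥-elim)
open import Data.Fin as Fin using (Fin; zero; suc; toℕ; inject₁)
open import Data.Fin.Subset using (∣_∣)
open import Data.Fin.Properties using (toℕ-inject₁; toℕ-fromℕ; ≤fromℕ; toℕ<n; toℕ-fromℕ<; any?)
  renaming (<-cmp to <-cmpᶠ; _≟_ to _≟ᶠ_)
import Data.Fin.Properties as Finₚ
open import Data.Fin.Induction using (<-weakInduction)
open import Data.List as List
  using (List; allFin; []; _∷_; _++_; [_]; _∷ʳ_; _ʳ++_; map; filter; applyUpTo; upTo;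
         cartesianProductWith)
open import Data.List.Properties
  using (applyUpTo-∷ʳ; map-++; filter-++; ∷-injectiveˡ; ∷-injectiveʳ; map-tabulate; map-cong; map-∘)
  renaming (tabulate-cong to tabulate-congᴸ)
open import Data.List.Membership.Propositional using (_∈_)
open import Data.List.Membership.Propositional.Properties
  using (∈-filter⁺; ∈-filter⁻; ∈-tabulate⁺; ∈-tabulate⁻; ∈-map⁺; ∈-map⁻; ∈-allFin;
         ∈-cartesianProductWith⁺)
import Data.List.Relation.Unary.Any.Properties as Any
open import Data.List.Relation.Unary.Any using (here; there)
open import Data.List.Relation.Unary.All as Allᴸ using (All; []; _∷_)
import Data.List.Relation.Unary.All.Properties as All
open import Data.List.Relation.Unary.Unique.Propositional using (Unique)
import Data.List.Relation.Unary.Unique.Propositional.Properties as Unique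
open import Data.List.Relation.Unary.Linked using (Linked)
open import Data.List.Relation.Unary.Linked.Properties using (AllPairs⇒Linked)
open import Data.List.Relation.Unary.Sorted.TotalOrder.Properties using (↗↭↗⇒≋)
open import Data.List.Relation.Binary.Pointwise using (Pointwise-≡⇒≡)
open import Data.List.Relation.Binary.Permutation.Propositional using (_↭_; ↭⇒↭ₛ)
import Data.List.Relation.Binary.Permutation.Propositional.Properties as ↭
open import Data.List.Relation.Binary.BagAndSetEquality using (∼bag⇒↭)
open import Data.List.Membership.Propositional.Properties.WithK using (unique∧set⇒bag)
open import Data.List.Relation.Unary.AllPairs as AllPairs using (AllPairs; []; _∷_)
import Data.List.Relation.Unary.AllPairs.Properties as AllPairs
open import Data.Nat as ℕ
  using (ℕ; zero; suc; _+_; _*_; _^_; _≤_; _<_; _≤′_; ≤′-refl; ≤′-step; z≤n; s≤s)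
open import Data.Nat.Properties
open import Data.Nat.ListAction using (sum)
open import Data.Nat.ListAction.Properties using (sum-↭)
open import Algebra.Properties.CommutativeSemigroup +-commutativeSemigroup using (x∙yz≈y∙xz)
open import Data.Product using (Σ; ∃; ∃₂; _×_; _,_; proj₁; proj₂; map₁)
open import Data.Vec as Vec using (Vec; []; _∷_; lookup; toList)
open import Data.Vec.Properties using (tabulate∘lookup; lookup∘tabulate; tabulate-cong; tabulate-∘)
  renaming (∷-injective to ∷-injectiveᵛ)
open import Data.Fin.Permutation using (Permutation′; _⟨$⟩ʳ_; _⟨$⟩ˡ_; inverseʳ)
open import Function.Bundles using (_⇔_; mk⇔; Injection)
open import Function.Properties.Inverse using (↔⇒↣)
open import Relation.Binary.Definitions using (tri<; tri≈; tri>)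
open import Relation.Binary.PropositionalEquality hiding ([_])
open import Relation.Nullary using (Dec; yes; no; does)
open import Relation.Nullary.Decidable using (does-⇔)
open import Function using (_∘_; case_of_)

map-filter-[x] : ∀ {A B : Set} (f : A → B) {P : A → Set} (P? : ∀ x → Dec (P x)) x →
  map f (filter P? [ x ]) ≡ (if does (P? x) then [ f x ] else [])
map-filter-[x] f P? x with does (P? x)
... | true  = refl
... | false = refl

∈-upTo⁺ : ∀ {p N} → p < N → p ∈ upTo N
∈-upTo⁺ p<N = Any.applyUpTo⁺ (λ p → p) refl p<N

∈-upTo⁻ : ∀ {p N} → p ∈ upTo N → p < N
∈-upTo⁻ p∈ with Any.applyUpTo⁻ (λ p → p) p∈
... | _ , q<N , refl = q<N

upTo-strictlySorted : ∀ N → AllPairs _<_ (upTo N)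
upTo-strictlySorted N = AllPairs.applyUpTo⁺₁ (λ p → p) N (λ i<j _ → i<j)

strictlySorted-≡ : ∀ {xs ys : List ℕ} → AllPairs _<_ xs → AllPairs _<_ ys →
  (∀ {z} → z ∈ xs ⇔ z ∈ ys) → xs ≡ ys
strictlySorted-≡ xs↗ ys↗ same =
  Pointwise-≡⇒≡ (↗↭↗⇒≋ ≤-totalOrder (sorted xs↗) (sorted ys↗) (↭⇒↭ₛ (∼bag⇒↭
    (unique∧set⇒bag (AllPairs.map <⇒≢ xs↗) (AllPairs.map <⇒≢ ys↗) same))))
  where
  sorted : ∀ {zs} → AllPairs _<_ zs → Linked _≤_ zs
  sorted zs↗ = AllPairs⇒Linked (AllPairs.map <⇒≤ zs↗)

AllPairs-tabulate⁻ : ∀ {A : Set} {R : A → A → Set} {m} {f : Fin m → A} →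
  AllPairs R (List.tabulate f) → ∀ {i j} → i Fin.< j → R (f i) (f j)
AllPairs-tabulate⁻ (fi~ ∷ _)  {zero}  {suc j} _         = All.tabulate⁻ fi~ j
AllPairs-tabulate⁻ (_ ∷ f~)  {suc i} {suc j} (s≤s i<j) = AllPairs-tabulate⁻ f~ i<j

map-≡-map⇒≡-map : ∀ {A B C : Set} {f : A → C} {g : B → C} (e : B → A) {xs ys} →
  (∀ {x y} → x ∈ xs → f x ≡ g y → x ≡ e y) → map f xs ≡ map g ys → xs ≡ map e ys
map-≡-map⇒≡-map e {[]}     {[]}     _   _  = refl
map-≡-map⇒≡-map e {x ∷ xs} {y ∷ ys} inv eq = cong₂ _∷_
  (inv (here refl) (∷-injectiveˡ eq)) (map-≡-map⇒≡-map e (inv ∘ there) (∷-injectiveʳ eq))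

unique-map-injectiveOn : ∀ {A B : Set} {P : A → Set} {f : A → B} {xs} → Unique xs → All P xs →
  (∀ {a b} → P a → P b → f a ≡ f b → a ≡ b) → Unique (map f xs)
unique-map-injectiveOn []           []         _   = []
unique-map-injectiveOn (x∉ ∷ u) (px ∷ ps) inj =
  All.map⁺ (Allᴸ.tabulate λ y∈ fx≡fy → Allᴸ.lookup x∉ y∈ (inj px (Allᴸ.lookup ps y∈) fx≡fy))
  ∷ unique-map-injectiveOn u ps inj

-- Occurrences of letters in words

occ-++ : ∀ {n} (v : Fin n) xs ys → occ v (xs ++ ys) ≡ occ v xs + occ v ys
occ-++ v []       ys = refl
occ-++ v (x ∷ xs) ys = trans (cong (_ +_) (occ-++ v xs ys)) (sym (+-assoc _ (occ v xs) (occ v ys)))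

occ-ʳ++ : ∀ {n} (v : Fin n) xs ys → occ v (xs ʳ++ ys) ≡ occ v xs + occ v ys
occ-ʳ++ v []       ys = refl
occ-ʳ++ v (x ∷ xs) ys = begin
  occ v (xs ʳ++ x ∷ ys)        ≡⟨ occ-ʳ++ v xs (x ∷ ys) ⟩
  occ v xs + (δ + occ v ys)    ≡⟨ x∙yz≈y∙xz (occ v xs) δ (occ v ys) ⟩
  δ + (occ v xs + occ v ys)    ≡⟨ +-assoc δ (occ v xs) (occ v ys) ⟨
  occ v (x ∷ xs) + occ v ys    ∎
  where
  open ≡-Reasoning
  δ = if does (v ≟ᶠ x) then 1 else 0

occ-∷ : ∀ {n} (v x : Fin n) xs → occ v (x ∷ xs) ≡ occ v [ x ] + occ v xs
occ-∷ v x xs = cong (_+ occ v xs) (sym (+-identityʳ _))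

occ-[x]-≡ : ∀ {n} {v x : Fin n} → x ≡ v → occ v [ x ] ≡ 1
occ-[x]-≡ {v = v} {x} x≡v with v ≟ᶠ x
... | yes _   = refl
... | no v≢x  = ⊥-elim (v≢x (sym x≡v))

occ-[x]-≢ : ∀ {n} {v x : Fin n} → x ≢ v → occ v [ x ] ≡ 0
occ-[x]-≢ {v = v} {x} x≢v with v ≟ᶠ x
... | yes v≡x = ⊥-elim (x≢v (sym v≡x))
... | no _    = refl

-- `seen` holds the letters already read, most recent first.
jthCopies-++ : ∀ {n} j (seen : List (Fin n)) xs ys →
  jthCopies j seen (xs ++ ys) ≡ jthCopies j seen xs ++ jthCopies j (xs ʳ++ seen) ys
jthCopies-++ j seen []       ys = refl
jthCopies-++ j seen (x ∷ xs) ys with does (occ x seen ℕ.≟ j)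
... | true  = cong (x ∷_) (jthCopies-++ j (x ∷ seen) xs ys)
... | false = jthCopies-++ j (x ∷ seen) xs ys

lookupOr : ∀ {A : Set} {N} → A → Vec A N → ℕ → A
lookupOr d []       p       = d
lookupOr d (x ∷ xs) zero    = x
lookupOr d (x ∷ xs) (suc p) = lookupOr d xs p

lookupOr-toℕ : ∀ {A : Set} {N} (d : A) (xs : Vec A N) i → lookupOr d xs (toℕ i) ≡ lookup xs i
lookupOr-toℕ d (x ∷ xs) zero    = refl
lookupOr-toℕ d (x ∷ xs) (suc i) = lookupOr-toℕ d xs i

toList-lookupOr : ∀ {A : Set} {N} (d : A) (xs : Vec A N) → toList xs ≡ applyUpTo (lookupOr d xs) N
toList-lookupOr d []       = refl
toList-lookupOr d (x ∷ xs) = cong (x ∷_) (toList-lookupOr d xs)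

-- Positions p ≥ N read as `default`.
module Word {n N : ℕ} (default : Fin n) (π : Vec (Fin n) N) where

  letter : ℕ → Fin n
  letter = lookupOr default π

  prefixOcc : Fin n → ℕ → ℕ
  prefixOcc v m = occ v (applyUpTo letter m)

  -- position p holds the (rank p + 1)-st copy of its letter
  rank : ℕ → ℕ
  rank p = prefixOcc (letter p) p

  copies : ℕ → List ℕ
  copies j = filter (λ p → rank p ℕ.≟ j) (upTo N)

  toList-letter : toList π ≡ applyUpTo letter N
  toList-letter = toList-lookupOr default π

  prefixOcc-suc : ∀ v m → prefixOcc v (suc m) ≡ prefixOcc v m + occ v [ letter m ]
  prefixOcc-suc v m = begin
    occ v (applyUpTo letter (suc m))          ≡⟨ cong (occ v) (applyUpTo-∷ʳ letter m) ⟨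
    occ v (applyUpTo letter m ∷ʳ letter m)    ≡⟨ occ-++ v (applyUpTo letter m) [ letter m ] ⟩
    prefixOcc v m + occ v [ letter m ]        ∎
    where open ≡-Reasoning

  prefixOcc-hit : ∀ {v} m → letter m ≡ v → prefixOcc v (suc m) ≡ suc (prefixOcc v m)
  prefixOcc-hit {v} m eq =
    trans (prefixOcc-suc v m) (trans (cong (prefixOcc v m +_) (occ-[x]-≡ eq)) (+-comm (prefixOcc v m) 1))

  prefixOcc-miss : ∀ {v} m → letter m ≢ v → prefixOcc v (suc m) ≡ prefixOcc v m
  prefixOcc-miss {v} m neq =
    trans (prefixOcc-suc v m) (trans (cong (prefixOcc v m +_) (occ-[x]-≢ neq)) (+-identityʳ _))

  prefixOcc-mono : ∀ v {m m′} → m ≤ m′ → prefixOcc v m ≤ prefixOcc v m′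
  prefixOcc-mono v m≤m′ = go (≤⇒≤′ m≤m′)
    where
    go : ∀ {m m′} → m ≤′ m′ → prefixOcc v m ≤ prefixOcc v m′
    go ≤′-refl               = ≤-refl
    go (≤′-step {m′} m≤′m′) =
      ≤-trans (go m≤′m′) (≤-trans (m≤m+n _ _) (≤-reflexive (sym (prefixOcc-suc v m′))))

  prefixOcc-constant : ∀ v {a b} → a ≤ b → (∀ q → a ≤ q → q < b → letter q ≢ v) →
    prefixOcc v b ≡ prefixOcc v a
  prefixOcc-constant v a≤b gap = go (≤⇒≤′ a≤b) gap
    where
    go : ∀ {a b} → a ≤′ b → (∀ q → a ≤ q → q < b → letter q ≢ v) → prefixOcc v b ≡ prefixOcc v a
    go ≤′-refl             _   = refl
    go (≤′-step {b} a≤′b) gap =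
      trans (prefixOcc-miss b (gap b (≤′⇒≤ a≤′b) ≤-refl))
            (go a≤′b (λ q a≤q q<b → gap q a≤q (m<n⇒m<1+n q<b)))

  jthCopies-prefix : ∀ j m →
    jthCopies j [] (applyUpTo letter m) ≡ map letter (filter (λ p → rank p ℕ.≟ j) (upTo m))
  jthCopies-prefix j zero    = refl
  jthCopies-prefix j (suc m) = begin
    jthCopies j [] (applyUpTo letter (suc m))
      ≡⟨ cong (jthCopies j []) (applyUpTo-∷ʳ letter m) ⟨
    jthCopies j [] (applyUpTo letter m ∷ʳ letter m)
      ≡⟨ jthCopies-++ j [] (applyUpTo letter m) [ letter m ] ⟩
    jthCopies j [] (applyUpTo letter m) ++ jthCopies j (applyUpTo letter m ʳ++ []) [ letter m ]
      ≡⟨ cong₂ _++_ (jthCopies-prefix j m) last ⟩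
    map letter (filter P? (upTo m)) ++ map letter (filter P? [ m ])
      ≡⟨ map-++ letter (filter P? (upTo m)) _ ⟨
    map letter (filter P? (upTo m) ++ filter P? [ m ])
      ≡⟨ cong (map letter) (filter-++ P? (upTo m) [ m ]) ⟨
    map letter (filter P? (upTo m ∷ʳ m))
      ≡⟨ cong (map letter ∘ filter P?) (applyUpTo-∷ʳ (λ p → p) m) ⟩
    map letter (filter P? (upTo (suc m)))
      ∎
    where
    open ≡-Reasoning
    P? = λ p → rank p ℕ.≟ j
    last : jthCopies j (applyUpTo letter m ʳ++ []) [ letter m ] ≡ map letter (filter P? [ m ])
    last = begin
      jthCopies j (applyUpTo letter m ʳ++ []) [ letter m ]
        ≡⟨ cong (λ c → if does (c ℕ.≟ j) then [ letter m ] else [])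
                (trans (occ-ʳ++ (letter m) (applyUpTo letter m) []) (+-identityʳ (rank m))) ⟩
      (if does (P? m) then [ letter m ] else [])
        ≡⟨ map-filter-[x] letter P? m ⟨
      map letter (filter P? [ m ])
        ∎

  jthCopies-≡-copies : ∀ j → jthCopies j [] (toList π) ≡ map letter (copies j)
  jthCopies-≡-copies j = trans (cong (jthCopies j []) toList-letter) (jthCopies-prefix j N)

  ∈-copies⁺ : ∀ {j p} → p < N → rank p ≡ j → p ∈ copies j
  ∈-copies⁺ {j} p<N rank≡j = ∈-filter⁺ (λ p → rank p ℕ.≟ j) (∈-upTo⁺ p<N) rank≡j

  ∈-copies⁻ : ∀ {j p} → p ∈ copies j → p < N × rank p ≡ j
  ∈-copies⁻ {j} p∈ with ∈-filter⁻ (λ p → rank p ℕ.≟ j) {xs = upTo N} p∈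
  ... | p∈upTo , rank≡j = ∈-upTo⁻ p∈upTo , rank≡j

  copies-strictlySorted : ∀ j → AllPairs _<_ (copies j)
  copies-strictlySorted j = AllPairs.filter⁺ (λ p → rank p ℕ.≟ j) (upTo-strictlySorted N)

  rank-< : ∀ {p m} → p < m → rank p < prefixOcc (letter p) m
  rank-< {p} {m} p<m = begin-strict
    rank p                       <⟨ n<1+n (rank p) ⟩
    suc (rank p)                 ≡⟨ prefixOcc-hit p refl ⟨
    prefixOcc (letter p) (suc p) ≤⟨ prefixOcc-mono (letter p) p<m ⟩
    prefixOcc (letter p) m       ∎
    where open ≤-Reasoning

  rank-strictMono : ∀ {p q} → p < q → letter p ≡ letter q → rank p < rank q
  rank-strictMono {p} {q} p<q same = subst (rank p <_) (cong (λ v → prefixOcc v q) same) (rank-< p<q)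

  rank-reflects-< : ∀ {p q} → letter p ≡ letter q → rank p < rank q → p < q
  rank-reflects-< {p} {q} same rank< with <-cmp p q
  ... | tri< p<q _ _ = p<q
  ... | tri≈ _ refl _ = ⊥-elim (<-irrefl refl rank<)
  ... | tri> _ _ q<p = ⊥-elim (<-asym rank< (rank-strictMono q<p (sym same)))

  rank-injective : ∀ {p q} → letter p ≡ letter q → rank p ≡ rank q → p ≡ q
  rank-injective {p} {q} same eq with <-cmp p q
  ... | tri< p<q _ _ = ⊥-elim (<-irrefl eq (rank-strictMono p<q same))
  ... | tri≈ _ p≡q _ = p≡q
  ... | tri> _ _ q<p = ⊥-elim (<-irrefl (sym eq) (rank-strictMono q<p (sym same)))

  module Enumeration {K} {v : Fin n} (f : Fin (suc K) → ℕ)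
    (f-strictMono : ∀ {c c′} → c Fin.< c′ → f c < f c′)
    (f-letter : ∀ c → letter (f c) ≡ v)
    (f-below : ∀ c → f c < N)
    (f-onto : ∀ q → q < N → letter q ≡ v → ∃ λ c → f c ≡ q)
    where

    f-reflects-< : ∀ {c c′} → f c < f c′ → c Fin.< c′
    f-reflects-< {c} {c′} fc<fc′ with <-cmpᶠ c c′
    ... | tri< c<c′ _ _ = c<c′
    ... | tri≈ _ refl _ = ⊥-elim (<-irrefl refl fc<fc′)
    ... | tri> _ _ c′<c = ⊥-elim (<-asym fc<fc′ (f-strictMono c′<c))

    prefixOcc-gap : ∀ {a b} → a ≤ b → b ≤ N → (∀ c → a ≤ f c → f c < b → ⊥) →
      prefixOcc v b ≡ prefixOcc v a
    prefixOcc-gap a≤b b≤N no-f = prefixOcc-constant v a≤b λ q a≤q q<b letter≡v →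
      let (c , fc≡q) = f-onto q (<-≤-trans q<b b≤N) letter≡v
      in no-f c (subst (_ ≤_) (sym fc≡q) a≤q) (subst (_< _) (sym fc≡q) q<b)

    prefixOcc-after : ∀ c → prefixOcc v (suc (f c)) ≡ suc (prefixOcc v (f c))
    prefixOcc-after c = prefixOcc-hit (f c) (f-letter c)

    prefixOcc-at : ∀ c → prefixOcc v (f c) ≡ toℕ c
    prefixOcc-at = <-weakInduction (λ c → prefixOcc v (f c) ≡ toℕ c) base step
      where
      base : prefixOcc v (f zero) ≡ 0
      base = prefixOcc-gap z≤n (<⇒≤ (f-below zero)) λ c _ fc<f0 → case f-reflects-< fc<f0 of λ ()
      step : ∀ c → prefixOcc v (f (inject₁ c)) ≡ toℕ (inject₁ c) →
        prefixOcc v (f (suc c)) ≡ suc (toℕ c)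
      step c ih = begin
        prefixOcc v (f (suc c))
          ≡⟨ prefixOcc-gap (f-strictMono c<1+c) (<⇒≤ (f-below (suc c))) no-f ⟩
        prefixOcc v (suc (f (inject₁ c)))  ≡⟨ prefixOcc-after (inject₁ c) ⟩
        suc (prefixOcc v (f (inject₁ c)))  ≡⟨ cong suc (trans ih (toℕ-inject₁ c)) ⟩
        suc (toℕ c)                        ∎
        where
        open ≡-Reasoning
        c<1+c : inject₁ c Fin.< suc c
        c<1+c = s≤s (≤-reflexive (toℕ-inject₁ c))
        no-f : ∀ c′ → suc (f (inject₁ c)) ≤ f c′ → f c′ < f (suc c) → ⊥
        no-f c′ after before = <-irrefl refl (<-≤-trans
          (subst (_< toℕ c′) (toℕ-inject₁ c) (f-reflects-< after))
          (ℕ.s≤s⁻¹ (f-reflects-< before)))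

    prefixOcc-total : prefixOcc v N ≡ suc K
    prefixOcc-total = begin
      prefixOcc v N                    ≡⟨ prefixOcc-gap (f-below last) ≤-refl no-f ⟩
      prefixOcc v (suc (f last))       ≡⟨ prefixOcc-after last ⟩
      suc (prefixOcc v (f last))       ≡⟨ cong suc (trans (prefixOcc-at last) (toℕ-fromℕ K)) ⟩
      suc K                            ∎
      where
      open ≡-Reasoning
      last = Fin.fromℕ K
      no-f : ∀ c → suc (f last) ≤ f c → f c < N → ⊥
      no-f c after _ = <⇒≱ (f-reflects-< after) (≤fromℕ c)

-- Occurrences of values in grids

m+n≡1∧0<n⇒m≡0 : ∀ {m n} → m + n ≡ 1 → 0 < n → m ≡ 0
m+n≡1∧0<n⇒m≡0 {zero}          _  _   = refl
m+n≡1∧0<n⇒m≡0 {suc m} {suc n} eq _ = ⊥-elim (m+1+n≢0 m (suc-injective eq))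

module _ {M : ℕ} {v : Fin M} where

  occ-toList-pos : ∀ {k} (xs : Vec (Fin M) k) {c} → lookup xs c ≡ v → 0 < occ v (toList xs)
  occ-toList-pos (x ∷ xs) {zero}  x≡v = begin-strict
    0                             <⟨ s≤s z≤n ⟩
    1                             ≡⟨ occ-[x]-≡ x≡v ⟨
    occ v [ x ]                   ≤⟨ m≤m+n _ _ ⟩
    occ v [ x ] + occ v (toList xs) ≡⟨ occ-∷ v x (toList xs) ⟨
    occ v (toList (x ∷ xs))       ∎
    where open ≤-Reasoning
  occ-toList-pos (x ∷ xs) {suc c} eq = <-≤-trans (occ-toList-pos xs eq) (m≤n+m _ _)

  occ-toList-≢0 : ∀ {k} (xs : Vec (Fin M) k) → occ v (toList xs) ≢ 0 → ∃ λ c → lookup xs c ≡ v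
  occ-toList-≢0 []       occ≢0 = ⊥-elim (occ≢0 refl)
  occ-toList-≢0 (x ∷ xs) occ≢0 with v ≟ᶠ x
  ... | yes v≡x = zero , sym v≡x
  ... | no _    = let (c , eq) = occ-toList-≢0 xs occ≢0 in suc c , eq

  occ-toList-≡0 : ∀ {k} (xs : Vec (Fin M) k) → (∀ c → lookup xs c ≢ v) → occ v (toList xs) ≡ 0
  occ-toList-≡0 []       _      = refl
  occ-toList-≡0 (x ∷ xs) absent = trans (occ-∷ v x (toList xs))
    (cong₂ _+_ (occ-[x]-≢ (absent zero)) (occ-toList-≡0 xs (absent ∘ suc)))

  occ-toList-≡1 : ∀ {k} (xs : Vec (Fin M) k) {c} → lookup xs c ≡ v →
    (∀ c′ → lookup xs c′ ≡ v → c′ ≡ c) → occ v (toList xs) ≡ 1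
  occ-toList-≡1 (x ∷ xs) {zero}  x≡v once = trans (occ-∷ v x (toList xs))
    (cong₂ _+_ (occ-[x]-≡ x≡v) (occ-toList-≡0 xs λ c′ eq → Finₚ.0≢1+n (sym (once (suc c′) eq))))
  occ-toList-≡1 (x ∷ xs) {suc c} eq  once = trans (occ-∷ v x (toList xs))
    (cong₂ _+_ (occ-[x]-≢ λ x≡v → Finₚ.0≢1+n (once zero x≡v))
               (occ-toList-≡1 xs eq λ c′ eq′ → Finₚ.suc-injective (once (suc c′) eq′)))

  -- occT and entry, for grids with any number of rows
  gridOcc : ∀ {k m} → Vec (Vec (Fin M) k) m → ℕ
  gridOcc G = sum (toList (Vec.map (λ row → occ v (toList row)) G))

  cell : ∀ {k m} → Vec (Vec (Fin M) k) m → Fin m → Fin k → Fin M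
  cell G r c = lookup (lookup G r) c

  gridOcc-pos : ∀ {k m} (G : Vec (Vec (Fin M) k) m) {r c} → cell G r c ≡ v → 0 < gridOcc G
  gridOcc-pos (row ∷ G) {zero}  eq = <-≤-trans (occ-toList-pos row eq) (m≤m+n _ _)
  gridOcc-pos (row ∷ G) {suc r} eq = <-≤-trans (gridOcc-pos G eq) (m≤n+m _ _)

  gridOcc-≢0 : ∀ {k m} (G : Vec (Vec (Fin M) k) m) → gridOcc G ≢ 0 → ∃₂ λ r c → cell G r c ≡ v
  gridOcc-≢0 []        occ≢0 = ⊥-elim (occ≢0 refl)
  gridOcc-≢0 (row ∷ G) occ≢0 with occ v (toList row) ℕ.≟ 0
  ... | no  row≢0 = let (c , eq) = occ-toList-≢0 row row≢0 in zero , c , eq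
  ... | yes row≡0 = let (r , c , eq) = gridOcc-≢0 G (occ≢0 ∘ cong₂ _+_ row≡0) in suc r , c , eq

  gridOcc-≡0 : ∀ {k m} (G : Vec (Vec (Fin M) k) m) → (∀ r c → cell G r c ≢ v) → gridOcc G ≡ 0
  gridOcc-≡0 []        _      = refl
  gridOcc-≡0 (row ∷ G) absent =
    cong₂ _+_ (occ-toList-≡0 row (absent zero)) (gridOcc-≡0 G (absent ∘ suc))

  gridOcc-≡1 : ∀ {k m} (G : Vec (Vec (Fin M) k) m) {r c} → cell G r c ≡ v →
    (∀ r′ c′ → cell G r′ c′ ≡ v → r′ ≡ r × c′ ≡ c) → gridOcc G ≡ 1
  gridOcc-≡1 (row ∷ G) {zero}  eq once = cong₂ _+_
    (occ-toList-≡1 row eq λ c′ eq′ → proj₂ (once zero c′ eq′))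
    (gridOcc-≡0 G λ r′ c′ eq′ → Finₚ.0≢1+n (sym (proj₁ (once (suc r′) c′ eq′))))
  gridOcc-≡1 (row ∷ G) {suc r} eq once = cong₂ _+_
    (occ-toList-≡0 row λ c′ eq′ → Finₚ.0≢1+n (proj₁ (once zero c′ eq′)))
    (gridOcc-≡1 G eq λ r′ c′ eq′ → map₁ Finₚ.suc-injective (once (suc r′) c′ eq′))

  gridOcc-≡1⇒sameRow : ∀ {k m} (G : Vec (Vec (Fin M) k) m) → gridOcc G ≡ 1 →
    ∀ {r c r′ c′} → cell G r c ≡ v → cell G r′ c′ ≡ v → r ≡ r′
  gridOcc-≡1⇒sameRow (row ∷ G) once {zero}  {_} {zero}   _  _   = refl
  gridOcc-≡1⇒sameRow (row ∷ G) once {zero}  {_} {suc r′} eq eq′ =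
    ⊥-elim (<-irrefl (sym (m+n≡1∧0<n⇒m≡0 once (gridOcc-pos G eq′))) (occ-toList-pos row eq))
  gridOcc-≡1⇒sameRow (row ∷ G) once {suc r} {_} {zero}   eq eq′ =
    ⊥-elim (<-irrefl (sym (m+n≡1∧0<n⇒m≡0 once (gridOcc-pos G eq))) (occ-toList-pos row eq′))
  gridOcc-≡1⇒sameRow (row ∷ G) once {suc r} {_} {suc r′} eq eq′ =
    cong suc (gridOcc-≡1⇒sameRow G rest-once eq eq′)
    where
    rest-once : gridOcc G ≡ 1
    rest-once = trans (cong (_+ gridOcc G) (sym (m+n≡1∧0<n⇒m≡0 once (gridOcc-pos G eq)))) once

-- Standard tableaux give canon permutations, injectively

σ-injective : ∀ {n} (σ : Permutation′ n) {a b} → σ ⟨$⟩ʳ a ≡ σ ⟨$⟩ʳ b → a ≡ b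
σ-injective σ = Injection.injective (↔⇒↣ σ)

tableau-ext : ∀ {k n} {T T′ : Tableau k n} → (∀ r c → entry T r c ≡ entry T′ r c) → T ≡ T′
tableau-ext {T = T} {T′} same = vec-ext T T′ λ r → vec-ext _ _ (same r)
  where
  vec-ext : ∀ {A : Set} {m} (u v : Vec A m) → (∀ i → lookup u i ≡ lookup v i) → u ≡ v
  vec-ext u v same = trans (sym (tabulate∘lookup u)) (trans (tabulate-cong same) (tabulate∘lookup v))

rowOf-sound : ∀ {k n} (T : Tableau k n) {i} → (∃₂ λ r c → entry T r c ≡ i) →
  ∃ λ c → entry T (rowOf T i) c ≡ i
rowOf-sound T {i} (r , c , eq) with any? (λ r → any? (λ c → entry T r c ≟ᶠ i))
... | yes (_ , found) = found
... | no  absent      = ⊥-elim (absent (r , c , eq))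

module StandardTableau {K n : ℕ} (σ : Permutation′ n) (default : Fin n)
  (T : Tableau (suc K) n) (syt : IsSYT T) where

  open Word default (canonWord σ T)

  private
    N = suc K * n
    once = proj₁ syt
    rows-increasing = proj₁ (proj₂ syt)
    columns-increasing = proj₂ (proj₂ syt)

  entry-exists : ∀ i → ∃₂ λ r c → entry T r c ≡ i
  entry-exists i = gridOcc-≢0 T λ occ≡0 → 0≢1+n (trans (sym occ≡0) (once i))

  entry-injective : ∀ {r c r′ c′} → entry T r c ≡ entry T r′ c′ → r ≡ r′ × c ≡ c′
  entry-injective {r} {c} {r′} {c′} eq with gridOcc-≡1⇒sameRow T (once _) refl (sym eq)
  ... | refl with <-cmpᶠ c c′
  ...   | tri< c<c′ _ _ = ⊥-elim (<-irrefl (cong toℕ eq) (rows-increasing r c c′ c<c′))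
  ...   | tri≈ _ c≡c′ _ = refl , c≡c′
  ...   | tri> _ _ c′<c = ⊥-elim (<-irrefl (cong toℕ (sym eq)) (rows-increasing r c′ c c′<c))

  rowOf-entry : ∀ r c → rowOf T (entry T r c) ≡ r
  rowOf-entry r c = proj₁ (entry-injective (proj₂ (rowOf-sound T (r , c , refl))))

  letter-toℕ : ∀ i → letter (toℕ i) ≡ σ ⟨$⟩ʳ rowOf T i
  letter-toℕ i =
    trans (lookupOr-toℕ default (canonWord σ T) i) (lookup∘tabulate (λ i → σ ⟨$⟩ʳ rowOf T i) i)

  letter-entry : ∀ r c → letter (toℕ (entry T r c)) ≡ σ ⟨$⟩ʳ r
  letter-entry r c = trans (letter-toℕ (entry T r c)) (cong (σ ⟨$⟩ʳ_) (rowOf-entry r c))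

  position-is-entry : ∀ {q} → q < N → ∃₂ λ r c → toℕ (entry T r c) ≡ q
  position-is-entry q<N with entry-exists (Fin.fromℕ< q<N)
  ... | r , c , eq = r , c , trans (cong toℕ eq) (toℕ-fromℕ< q<N)

  copies-of-σr-in-row : ∀ r q → q < N → letter q ≡ σ ⟨$⟩ʳ r → ∃ λ c → toℕ (entry T r c) ≡ q
  copies-of-σr-in-row r q q<N letter≡σr with position-is-entry q<N
  ... | r′ , c , refl with σ-injective σ (trans (sym (letter-entry r′ c)) letter≡σr)
  ...   | refl = c , refl

  module Row (r : Fin n) = Enumeration (λ c → toℕ (entry T r c)) (rows-increasing r _ _)
    (λ c → letter-entry r c) (λ c → toℕ<n (entry T r c)) (copies-of-σr-in-row r)

  rank-entry : ∀ r c → rank (toℕ (entry T r c)) ≡ toℕ c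
  rank-entry r c =
    trans (cong (λ v → prefixOcc v (toℕ (entry T r c))) (letter-entry r c)) (Row.prefixOcc-at r c)

  canonWord-occ : ∀ v → occ v (toList (canonWord σ T)) ≡ suc K
  canonWord-occ v = begin
    occ v (toList (canonWord σ T))          ≡⟨ cong (occ v) toList-letter ⟩
    prefixOcc v N                           ≡⟨ cong (λ v → prefixOcc v N) (inverseʳ σ) ⟨
    prefixOcc (σ ⟨$⟩ʳ (σ ⟨$⟩ˡ v)) N          ≡⟨ Row.prefixOcc-total (σ ⟨$⟩ˡ v) ⟩
    suc K                                   ∎
    where open ≡-Reasoning

  column : Fin (suc K) → List ℕ
  column c = List.tabulate (λ r → toℕ (entry T r c))

  copies-≡-column : ∀ c → copies (toℕ c) ≡ column c
  copies-≡-column c = strictlySorted-≡ (copies-strictlySorted (toℕ c))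
    (AllPairs.tabulate⁺-< λ r<r′ → columns-increasing _ _ c r<r′) (mk⇔ to from)
    where
    to : ∀ {p} → p ∈ copies (toℕ c) → p ∈ column c
    to p∈ with ∈-copies⁻ p∈
    ... | p<N , rank≡c with position-is-entry p<N
    ...   | r , c′ , refl with Finₚ.toℕ-injective (trans (sym (rank-entry r c′)) rank≡c)
    ...     | refl = ∈-tabulate⁺ r
    from : ∀ {p} → p ∈ column c → p ∈ copies (toℕ c)
    from p∈ with ∈-tabulate⁻ p∈
    ... | r , refl = ∈-copies⁺ (toℕ<n (entry T r c)) (rank-entry r c)

  canonWord-jthCopies : ∀ c → jthCopies (toℕ c) [] (toList (canonWord σ T)) ≡ permWord σ
  canonWord-jthCopies c = begin
    jthCopies (toℕ c) [] (toList (canonWord σ T))   ≡⟨ jthCopies-≡-copies (toℕ c) ⟩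
    map letter (copies (toℕ c))                      ≡⟨ cong (map letter) (copies-≡-column c) ⟩
    map letter (column c)                            ≡⟨ map-tabulate _ letter ⟩
    List.tabulate (λ r → letter (toℕ (entry T r c))) ≡⟨ tabulate-congᴸ (λ r → letter-entry r c) ⟩
    List.tabulate (σ ⟨$⟩ʳ_)                           ≡⟨ map-tabulate (λ r → r) (σ ⟨$⟩ʳ_) ⟨
    permWord σ                                       ∎
    where open ≡-Reasoning

  canonWord-isCanon : IsCanon (suc K) σ (canonWord σ T)
  canonWord-isCanon = canonWord-occ , canonWord-jthCopies

  entry-holds-copy : ∀ {π} → canonWord σ T ≡ π → ∀ r c →
    Word.letter default π (toℕ (entry T r c)) ≡ σ ⟨$⟩ʳ r ×
    Word.rank default π (toℕ (entry T r c)) ≡ toℕ c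
  entry-holds-copy refl r c = letter-entry r c , rank-entry r c

canonWord-injective : ∀ {K n} (σ : Permutation′ n) (default : Fin n) {T T′ : Tableau (suc K) n} →
  IsSYT T → IsSYT T′ → canonWord σ T ≡ canonWord σ T′ → T ≡ T′
canonWord-injective σ default {T} {T′} syt syt′ eq = tableau-ext λ r c →
  let (letter≡ , rank≡)  = StandardTableau.entry-holds-copy σ default T syt refl r c
      (letter≡′ , rank≡′) = StandardTableau.entry-holds-copy σ default T′ syt′ (sym eq) r c
  in Finₚ.toℕ-injective (Word.rank-injective default (canonWord σ T)
       (trans letter≡ (sym letter≡′)) (trans rank≡ (sym rank≡′)))

-- Every canon permutation comes from a standard tableau

module CanonPermutation {K n : ℕ} (σ : Permutation′ n) (default : Fin n)
  (π : Vec (Fin n) (suc K * n)) (canon : IsCanon (suc K) σ π) where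

  open Word default π

  private
    N = suc K * n

  copies-letters : ∀ c → map letter (copies (toℕ c)) ≡ permWord σ
  copies-letters c = trans (sym (jthCopies-≡-copies (toℕ c))) (proj₂ canon c)

  rank-<-copies : ∀ {p} → p < N → rank p < suc K
  rank-<-copies {p} p<N = subst (rank p <_)
    (trans (cong (occ (letter p)) (sym toList-letter)) (proj₁ canon (letter p))) (rank-< p<N)

  -- Opaque: unfolding this proof term makes checking the tableau below blow up.
  opaque
    copy : (r : Fin n) (c : Fin (suc K)) → ∃ λ p → p ∈ copies (toℕ c) × σ ⟨$⟩ʳ r ≡ letter p
    copy r c = ∈-map⁻ letter
      (subst (σ ⟨$⟩ʳ r ∈_) (sym (copies-letters c)) (∈-map⁺ (σ ⟨$⟩ʳ_) (∈-allFin r)))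

  -- position of the (c+1)-st copy of σ r
  copyAt : Fin n → Fin (suc K) → ℕ
  copyAt r c = proj₁ (copy r c)

  copyAt-< : ∀ r c → copyAt r c < N
  copyAt-< r c = proj₁ (∈-copies⁻ (proj₁ (proj₂ (copy r c))))

  rank-copyAt : ∀ r c → rank (copyAt r c) ≡ toℕ c
  rank-copyAt r c = proj₂ (∈-copies⁻ (proj₁ (proj₂ (copy r c))))

  letter-copyAt : ∀ r c → letter (copyAt r c) ≡ σ ⟨$⟩ʳ r
  letter-copyAt r c = sym (proj₂ (proj₂ (copy r c)))

  copyAt-unique : ∀ {p r c} → letter p ≡ σ ⟨$⟩ʳ r → rank p ≡ toℕ c → p ≡ copyAt r c
  copyAt-unique letter≡ rank≡ =
    rank-injective (trans letter≡ (sym (letter-copyAt _ _))) (trans rank≡ (sym (rank-copyAt _ _)))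

  copyAt-injective : ∀ {r c r′ c′} → copyAt r c ≡ copyAt r′ c′ → r ≡ r′ × c ≡ c′
  copyAt-injective {r} {c} {r′} {c′} eq =
    σ-injective σ (trans (sym (letter-copyAt r c)) (trans (cong letter eq) (letter-copyAt r′ c′))) ,
    Finₚ.toℕ-injective (trans (sym (rank-copyAt r c)) (trans (cong rank eq) (rank-copyAt r′ c′)))

  position-is-copyAt : ∀ {p} → p < N → ∃₂ λ r c → copyAt r c ≡ p
  position-is-copyAt {p} p<N = r , c , sym (copyAt-unique letter≡ (sym (toℕ-fromℕ< (rank-<-copies p<N))))
    where
    r = σ ⟨$⟩ˡ letter p
    c = Fin.fromℕ< (rank-<-copies p<N)
    letter≡ : letter p ≡ σ ⟨$⟩ʳ r
    letter≡ = sym (inverseʳ σ)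

  copies-≡-tabulate : ∀ c → copies (toℕ c) ≡ List.tabulate (λ r → copyAt r c)
  copies-≡-tabulate c = trans
    (map-≡-map⇒≡-map (λ r → copyAt r c)
      (λ p∈ letter≡ → copyAt-unique letter≡ (proj₂ (∈-copies⁻ p∈))) (copies-letters c))
    (map-tabulate (λ r → r) (λ r → copyAt r c))

  copyAt-increasing-in-row : ∀ r {c c′} → c Fin.< c′ → copyAt r c < copyAt r c′
  copyAt-increasing-in-row r {c} {c′} c<c′ = rank-reflects-<
    (trans (letter-copyAt r c) (sym (letter-copyAt r c′)))
    (subst₂ _<_ (sym (rank-copyAt r c)) (sym (rank-copyAt r c′)) c<c′)

  copyAt-increasing-in-column : ∀ c {r r′} → r Fin.< r′ → copyAt r c < copyAt r′ c
  copyAt-increasing-in-column c = AllPairs-tabulate⁻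
    (subst (AllPairs _<_) (copies-≡-tabulate c) (copies-strictlySorted (toℕ c)))

  cellAt : Fin n → Fin (suc K) → Fin N
  cellAt r c = Fin.fromℕ< (copyAt-< r c)

  tableau : Tableau (suc K) n
  tableau = Vec.tabulate λ r → Vec.tabulate (cellAt r)

  toℕ-entry : ∀ r c → toℕ (entry tableau r c) ≡ copyAt r c
  toℕ-entry r c = begin
    toℕ (lookup (lookup tableau r) c)
      ≡⟨ cong (λ row → toℕ (lookup row c)) (lookup∘tabulate (Vec.tabulate ∘ cellAt) r) ⟩
    toℕ (lookup (Vec.tabulate (cellAt r)) c)     ≡⟨ cong toℕ (lookup∘tabulate (cellAt r) c) ⟩
    toℕ (cellAt r c)                             ≡⟨ toℕ-fromℕ< (copyAt-< r c) ⟩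
    copyAt r c                                   ∎
    where open ≡-Reasoning

  entry-exists : ∀ i → ∃₂ λ r c → entry tableau r c ≡ i
  entry-exists i with position-is-copyAt (toℕ<n i)
  ... | r , c , eq = r , c , Finₚ.toℕ-injective (trans (toℕ-entry r c) eq)

  entry-injective : ∀ {r c r′ c′} → entry tableau r c ≡ entry tableau r′ c′ → r ≡ r′ × c ≡ c′
  entry-injective {r} {c} {r′} {c′} eq =
    copyAt-injective (trans (sym (toℕ-entry r c)) (trans (cong toℕ eq) (toℕ-entry r′ c′)))

  tableau-isSYT : IsSYT tableau
  tableau-isSYT = once , rows-increasing , columns-increasing
    where
    once : ∀ i → occT tableau i ≡ 1
    once i with entry-exists i
    ... | r , c , eq = gridOcc-≡1 tableau eq λ r′ c′ eq′ → entry-injective (trans eq′ (sym eq))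
    rows-increasing : ∀ r c c′ → c Fin.< c′ → entry tableau r c Fin.< entry tableau r c′
    rows-increasing r c c′ c<c′ = subst₂ _<_ (sym (toℕ-entry r c)) (sym (toℕ-entry r c′))
      (copyAt-increasing-in-row r c<c′)
    columns-increasing : ∀ r r′ c → r Fin.< r′ → entry tableau r c Fin.< entry tableau r′ c
    columns-increasing r r′ c r<r′ = subst₂ _<_ (sym (toℕ-entry r c)) (sym (toℕ-entry r′ c))
      (copyAt-increasing-in-column c r<r′)

  canonWord-tableau : canonWord σ tableau ≡ π
  canonWord-tableau = trans (tabulate-cong letter-of-row) (tabulate∘lookup π)
    where
    letter-of-row : ∀ i → σ ⟨$⟩ʳ rowOf tableau i ≡ lookup π i
    letter-of-row i = begin
      σ ⟨$⟩ʳ r                 ≡⟨ letter-copyAt r c ⟨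
      letter (copyAt r c)     ≡⟨ cong letter (trans (sym (toℕ-entry r c)) (cong toℕ eq)) ⟩
      letter (toℕ i)          ≡⟨ lookupOr-toℕ default π i ⟩
      lookup π i              ∎
      where
      open ≡-Reasoning
      r : Fin n
      r = rowOf tableau i
      found : ∃ λ c → entry tableau r c ≡ i
      found = rowOf-sound tableau (entry-exists i)
      c : Fin (suc K)
      c = proj₁ found
      eq : entry tableau r c ≡ i
      eq = proj₂ found

-- Descents, plateaux and generating functions

adjSet-map : ∀ {A B : Set} {m} {R : B → B → Bool} {R′ : A → A → Bool} (f : A → B) →
  (∀ a b → R (f a) (f b) ≡ R′ a b) → (xs : Vec A m) → adjSet R (Vec.map f xs) ≡ adjSet R′ xs
adjSet-map f R≡R′ []           = refl
adjSet-map f R≡R′ (x ∷ [])     = refl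
adjSet-map f R≡R′ (x ∷ y ∷ xs) = cong₂ _∷_ (cong toSide (R≡R′ x y)) (adjSet-map f R≡R′ (y ∷ xs))

module _ {k n} (σ : Permutation′ n) (T : Tableau k n) where

  canonWord-≡-map-rowWord : canonWord σ T ≡ Vec.map (σ ⟨$⟩ʳ_) (rowWord T)
  canonWord-≡-map-rowWord = tabulate-∘ (σ ⟨$⟩ʳ_) (rowOf T)

  Desσ-≡-Des : Desσ σ T ≡ Des (canonWord σ T)
  Desσ-≡-Des = sym (trans (cong Des canonWord-≡-map-rowWord)
    (adjSet-map (σ ⟨$⟩ʳ_) (λ _ _ → refl) (rowWord T)))

  PlatT-≡-Plat : PlatT T ≡ Plat (canonWord σ T)
  PlatT-≡-Plat = sym (trans (cong Plat canonWord-≡-map-rowWord)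
    (adjSet-map (σ ⟨$⟩ʳ_) same-equality (rowWord T)))
    where
    same-equality : ∀ a b → does ((σ ⟨$⟩ʳ a) ≟ᶠ (σ ⟨$⟩ʳ b)) ≡ does (a ≟ᶠ b)
    same-equality a b =
      does-⇔ (mk⇔ (σ-injective σ) (cong (σ ⟨$⟩ʳ_))) ((σ ⟨$⟩ʳ a) ≟ᶠ (σ ⟨$⟩ʳ b)) (a ≟ᶠ b)

allVecs-suc : ∀ {A : Set} (xs : List A) m →
  allVecs xs (suc m) ≡ cartesianProductWith _∷_ xs (allVecs xs m)
allVecs-suc xs m = concatMap-prepend xs
  where
  concatMap-prepend : ∀ ys →
    List.concatMap (λ y → map (y ∷_) (allVecs xs m)) ys ≡ cartesianProductWith _∷_ ys (allVecs xs m)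
  concatMap-prepend []       = refl
  concatMap-prepend (y ∷ ys) = cong (map (y ∷_) (allVecs xs m) ++_) (concatMap-prepend ys)

∈-allVecs : ∀ {A : Set} {xs : List A} → (∀ a → a ∈ xs) → ∀ {m} (v : Vec A m) → v ∈ allVecs xs m
∈-allVecs every []      = here refl
∈-allVecs {xs = xs} every {suc m} (a ∷ v) = subst ((a ∷ v) ∈_) (sym (allVecs-suc xs m))
  (∈-cartesianProductWith⁺ _∷_ (every a) (∈-allVecs every v))

allVecs-unique : ∀ {A : Set} {xs : List A} → Unique xs → ∀ m → Unique (allVecs xs m)
allVecs-unique u zero    = [] ∷ []
allVecs-unique {xs = xs} u (suc m) = subst Unique (sym (allVecs-suc xs m))
  (Unique.cartesianProductWith⁺ _∷_ ∷-injectiveᵛ u (allVecs-unique u m))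

module _ {k n : ℕ} (σ : Permutation′ n) where

  private
    allTableaux = allVecs (allVecs (allFin (k * n)) k) n
    allWords = allVecs (allFin n) (k * n)

  ∈-allSYT⁺ : ∀ {T : Tableau k n} → IsSYT T → T ∈ allSYT k n
  ∈-allSYT⁺ {T} = ∈-filter⁺ isSYT? (∈-allVecs (∈-allVecs ∈-allFin) T)

  ∈-allSYT⁻ : ∀ {T : Tableau k n} → T ∈ allSYT k n → IsSYT T
  ∈-allSYT⁻ T∈ = proj₂ (∈-filter⁻ isSYT? {xs = allTableaux} T∈)

  ∈-allCanon⁺ : ∀ {π} → IsCanon k σ π → π ∈ allCanon k σ
  ∈-allCanon⁺ {π} = ∈-filter⁺ (isCanon? k σ) (∈-allVecs ∈-allFin π)

  ∈-allCanon⁻ : ∀ {π} → π ∈ allCanon k σ → IsCanon k σ π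
  ∈-allCanon⁻ π∈ = proj₂ (∈-filter⁻ (isCanon? k σ) {xs = allWords} π∈)

  allSYT-unique : Unique (allSYT k n)
  allSYT-unique = Unique.filter⁺ isSYT? (allVecs-unique (allVecs-unique (Unique.allFin⁺ (k * n)) k) n)

  allCanon-unique : Unique (allCanon k σ)
  allCanon-unique = Unique.filter⁺ (isCanon? k σ) (allVecs-unique (Unique.allFin⁺ n) (k * n))

  SYTgf-≡-C :
    ((T : Tableau k n) → IsSYT T → IsCanon k σ (canonWord σ T)) →
    (∀ {T T′ : Tableau k n} → IsSYT T → IsSYT T′ → canonWord σ T ≡ canonWord σ T′ → T ≡ T′) →
    ((π : Vec (Fin n) (k * n)) → IsCanon k σ π → ∃ λ (T : Tableau k n) → IsSYT T × canonWord σ T ≡ π) →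
    ∀ t u → SYTgf k n σ t u ≡ C k σ t u
  SYTgf-≡-C canonical injective surjective t u = begin
    sum (map (λ T → t ^ desσ σ T * u ^ platT T) (allSYT k n))
      ≡⟨ cong sum (map-cong statistics (allSYT k n)) ⟩
    sum (map (weight ∘ canonWord σ) (allSYT k n))
      ≡⟨ cong sum (map-∘ (allSYT k n)) ⟩
    sum (map weight (map (canonWord σ) (allSYT k n)))
      ≡⟨ sum-↭ (↭.map⁺ weight image↭allCanon) ⟩
    sum (map weight (allCanon k σ))
      ∎
    where
    open ≡-Reasoning
    weight : Vec (Fin n) (k * n) → ℕ
    weight π = t ^ des π * u ^ plat π
    statistics : ∀ T → t ^ desσ σ T * u ^ platT T ≡ weight (canonWord σ T)
    statistics T = cong₂ (λ D P → t ^ ∣ D ∣ * u ^ ∣ P ∣) (Desσ-≡-Des σ T) (PlatT-≡-Plat σ T)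
    image-unique : Unique (map (canonWord σ) (allSYT k n))
    image-unique = unique-map-injectiveOn allSYT-unique (Allᴸ.tabulate ∈-allSYT⁻) injective
    image⇔allCanon : ∀ {π} → π ∈ map (canonWord σ) (allSYT k n) ⇔ π ∈ allCanon k σ
    image⇔allCanon = mk⇔
      (λ π∈ → let (T , T∈ , π≡) = ∈-map⁻ (canonWord σ) π∈
              in subst (_∈ allCanon k σ) (sym π≡) (∈-allCanon⁺ (canonical T (∈-allSYT⁻ T∈))))
      (λ π∈ → let (T , syt , π≡) = surjective _ (∈-allCanon⁻ π∈)
              in subst (_∈ map (canonWord σ) (allSYT k n)) π≡ (∈-map⁺ (canonWord σ) (∈-allSYT⁺ syt)))
    image↭allCanon : map (canonWord σ) (allSYT k n) ↭ allCanon k σ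
    image↭allCanon = ∼bag⇒↭ (unique∧set⇒bag image-unique allCanon-unique image⇔allCanon)

lemma2p3 : (n k : ℕ) → 1 ≤ n → 1 ≤ k → (σ : Permutation′ n) →
    ((T : Tableau k n) → IsSYT T → IsCanon k σ (canonWord σ T)) ×
    ((T T′ : Tableau k n) → IsSYT T → IsSYT T′ → canonWord σ T ≡ canonWord σ T′ → T ≡ T′) ×
    ((π : Vec (Fin n) (k * n)) → IsCanon k σ π → Σ (Tableau k n) (λ T → IsSYT T × canonWord σ T ≡ π)) ×
    ((T : Tableau k n) → IsSYT T → (Desσ σ T ≡ Des (canonWord σ T)) × (PlatT T ≡ Plat (canonWord σ T))) ×
    ((t u : ℕ) → SYTgf k n σ t u ≡ C k σ t u)
lemma2p3 (suc n) (suc k) _ _ σ =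
  canonical , (λ T T′ → injective) , surjective , statistics , SYTgf-≡-C σ canonical injective surjective
  where
  canonical : (T : Tableau (suc k) (suc n)) → IsSYT T → IsCanon (suc k) σ (canonWord σ T)
  canonical T syt = StandardTableau.canonWord-isCanon σ zero T syt
  injective : ∀ {T T′ : Tableau (suc k) (suc n)} → IsSYT T → IsSYT T′ →
    canonWord σ T ≡ canonWord σ T′ → T ≡ T′
  injective = canonWord-injective σ zero
  surjective : (π : Vec (Fin (suc n)) (suc k * suc n)) → IsCanon (suc k) σ π →
    Σ (Tableau (suc k) (suc n)) (λ T → IsSYT T × canonWord σ T ≡ π)
  surjective π canon = tableau , tableau-isSYT , canonWord-tableau
    where open CanonPermutation σ zero π canon
  statistics : (T : Tableau (suc k) (suc n)) → IsSYT T →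
    (Desσ σ T ≡ Des (canonWord σ T)) × (PlatT T ≡ Plat (canonWord σ T))
  statistics T _ = Desσ-≡-Des σ T , PlatT-≡-Plat σ T
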